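{- Let $w=w_1w_2\cdots w_n$ be a word of length $n\ge 2$ over an alphabet $\Sigma$ (with $w_i\in\Sigma$) such that $w_1=w_n$. Then $SP_{n-2}(w)\le\lceil n/2\rceil$.
   Context: A scattered subword of $w$ is a (not necessarily contiguous) subsequence of $w$. A palindrome is a word equal to its reversal. For $t\ge 0$, $SP_t(w)$ is the number of distinct palindromes of length $t$ that are scattered subwords of $w$. -}

module Defs where

open import Data.Nat.Base using (ℕ; zero; suc)
open import Data.List.Base using (List; []; _∷_; _++_; map; filter; reverse; length; deduplicate)
open import Data.List.Properties using (≡-dec)
open import Relation.Binary.Definitions using (DecidableEquality)
open import Relation.Binary.PropositionalEquality using (_≡_)

scatteredSubwords : {A : Set} → ℕ → List A → List (List A)
scatteredSubwords zero    _        = [] ∷ []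
scatteredSubwords (suc t) []       = []
scatteredSubwords (suc t) (x ∷ w) =
  map (x ∷_) (scatteredSubwords t w) ++ scatteredSubwords (suc t) w

IsPalindrome : {A : Set} → List A → Set
IsPalindrome u = u ≡ reverse u

SP : {A : Set} → DecidableEquality A → ℕ → List A → ℕ
SP _≟_ t w =
  length (deduplicate (≡-dec _≟_)
    (filter (λ u → ≡-dec _≟_ u (reverse u)) (scatteredSubwords t w)))

open import Data.Nat.Base using (_≤_; _<_; _∸_; s≤s; z≤n)
open import Data.Nat.Properties using (<-≤-trans; m∸n≤m)
open import Data.Fin.Base using (fromℕ<)
open import Data.List.Base using (lookup)

firstLetter : {A : Set} (w : List A) → 2 ≤ length w → A
firstLetter w n2 = lookup w (fromℕ< {0} (<-≤-trans (s≤s z≤n) n2))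

lastLetter : {A : Set} (w : List A) → 2 ≤ length w → A
lastLetter w n2 = lookup w (fromℕ< {length w ∸ 1} (m∸1<m w n2))
  where
  m∸1<m : {A : Set} (w : List A) → 2 ≤ length w → length w ∸ 1 < length w
  m∸1<m (_ ∷ w) _ = s≤s (m∸n≤m (length w) 0)

{-# OPTIONS --safe #-}
-- A palindrome of length n − 2 inside a x a (so |x| = n − 2) is either x itself or a z a with z a
-- palindrome of length n − 4 inside x; hence SP_{n−2}(a x a) ≤ [x is a palindrome] + SP_{n−4}(x).
-- Write x = b y d. If b = d, the recursion gains 1 for every two letters peeled off. If b ≠ d, then x is
-- not a palindrome and no palindrome inside x uses both of its end letters, so
-- SP_{n−4}(x) ≤ SP_{n−4}(b y) + SP_{n−4}(y d) ≤ 2 + 2: a word of length m has at most two palindromic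
-- subwords of length m − 1, by the same peeling one level down.

module Submission where

open import Defs
open import Data.Nat.Base using (ℕ; suc; _+_; _≤_; _<_; _∸_; ⌈_/2⌉; z≤n; s≤s)
open import Data.Nat.Properties
  using (≤-refl; ≤-trans; ≤-reflexive; +-comm; +-mono-≤; suc-injective; <⇒≱)
open import Data.Fin.Base using (fromℕ<)
open import Data.List.Base
  using (List; []; _∷_; _++_; map; filter; reverse; length; deduplicate; lookup)
open import Data.List.Properties
  using ( ≡-dec; length-++; length-++-sucʳ; length-map; ∷-injective; ∷-injectiveˡ; ∷ʳ-injective
        ; reverse-++; unfold-reverse)
open import Data.List.Reverse using (reverseView; []; _∶_∶ʳ_)
open import Data.List.Membership.Propositional using (_∈_)
open import Data.List.Membership.Propositional.Properties
  using (∈-map⁺; ∈-map⁻; ∈-++⁺ˡ; ∈-++⁺ʳ; ∈-++⁻; ∈-∃++; ∈-filter⁻; ∈-deduplicate⁻)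
open import Data.List.Relation.Binary.Sublist.Propositional
  using (_⊆_; []; _∷_; _∷ʳ_; ⊆-refl; ⊆-trans; to∈) renaming (lookup to ⊆-lookup)
open import Data.List.Relation.Binary.Sublist.Propositional.Properties
  using (∷ˡ⁻; ++⁺ʳ; length-mono-≤; to-≋; []⊆-universal)
open import Data.List.Relation.Binary.Equality.Propositional using (≋⇒≡)
import Data.List.Relation.Unary.All as All
open import Data.List.Relation.Unary.Any using (here; there)
open import Data.List.Relation.Unary.AllPairs using (_∷_)
open import Data.List.Relation.Unary.Unique.Propositional using (Unique)
import Data.List.Relation.Unary.Unique.DecPropositional.Properties as UniqueDec
open import Data.Product using (∃-syntax; _×_; _,_; proj₁; proj₂)
open import Data.Sum using (_⊎_; inj₁; inj₂)
open import Data.Empty using (⊥-elim)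
open import Function using (_∘_)
open import Relation.Nullary using (¬_; yes; no)
open import Relation.Binary.Definitions using (DecidableEquality)
open import Relation.Binary.PropositionalEquality
  using (_≡_; refl; sym; trans; cong; subst; module ≡-Reasoning)

module _ {A : Set} where

  wrap : A → List A → A → List A
  wrap a x c = a ∷ x ++ c ∷ []

  length-snoc : ∀ (x : List A) c → length (x ++ c ∷ []) ≡ suc (length x)
  length-snoc x c = trans (length-++ x) (+-comm (length x) 1)

  length-wrap : ∀ a (x : List A) c → length (wrap a x c) ≡ suc (suc (length x))
  length-wrap a x c = cong suc (length-snoc x c)

  reverse-wrap : ∀ a (x : List A) c → reverse (wrap a x c) ≡ wrap c (reverse x) a
  reverse-wrap a x c = begin
    reverse ((a ∷ x) ++ c ∷ [])  ≡⟨ reverse-++ (a ∷ x) (c ∷ []) ⟩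
    c ∷ reverse (a ∷ x)          ≡⟨ cong (c ∷_) (unfold-reverse a x) ⟩
    wrap c (reverse x) a         ∎
    where open ≡-Reasoning

  wrap-palindrome⁻ : ∀ {a c} {x : List A} → IsPalindrome (wrap a x c) → a ≡ c × IsPalindrome x
  wrap-palindrome⁻ {a} {c} {x} pal with ∷-injective (trans pal (reverse-wrap a x c))
  ... | a≡c , x∷ʳc≡ = a≡c , proj₁ (∷ʳ-injective x (reverse x) x∷ʳc≡)

  ⊆⇒≡ : ∀ {u w : List A} → u ⊆ w → length u ≡ length w → u ≡ w
  ⊆⇒≡ u⊆w ∣u∣≡∣w∣ = ≋⇒≡ (to-≋ ∣u∣≡∣w∣ u⊆w)

  ⊆-snoc⁻ : ∀ {u} (x : List A) {c} → u ⊆ x ++ c ∷ [] →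
            u ⊆ x ⊎ ∃[ v ] u ≡ v ++ c ∷ [] × v ⊆ x
  ⊆-snoc⁻ []      (_ ∷ʳ u⊆[]) = inj₁ u⊆[]
  ⊆-snoc⁻ []      (refl ∷ []) = inj₂ ([] , refl , [])
  ⊆-snoc⁻ (y ∷ x) (.y ∷ʳ s) with ⊆-snoc⁻ x s
  ... | inj₁ u⊆x            = inj₁ (y ∷ʳ u⊆x)
  ... | inj₂ (v , eq , v⊆x) = inj₂ (v , eq , y ∷ʳ v⊆x)
  ⊆-snoc⁻ (y ∷ x) (refl ∷ s) with ⊆-snoc⁻ x s
  ... | inj₁ u⊆x              = inj₁ (refl ∷ u⊆x)
  ... | inj₂ (v , refl , v⊆x) = inj₂ (y ∷ v , refl , refl ∷ v⊆x)

  palindrome-⊆-wrap-distinct : ∀ {a c} {x u : List A} → ¬ a ≡ c → IsPalindrome u →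
                               u ⊆ wrap a x c → u ⊆ a ∷ x ⊎ u ⊆ x ++ c ∷ []
  palindrome-⊆-wrap-distinct         _   _   (_ ∷ʳ s) = inj₂ s
  palindrome-⊆-wrap-distinct {x = x} a≢c pal (refl ∷ s) with ⊆-snoc⁻ x s
  ... | inj₁ u⊆x             = inj₁ (refl ∷ u⊆x)
  ... | inj₂ (_ , refl , _)  = ⊥-elim (a≢c (proj₁ (wrap-palindrome⁻ pal)))

  palindrome-⊆-wrap : ∀ {a} {x u : List A} → IsPalindrome u → u ⊆ wrap a x a →
                      u ⊆ x ⊎ u ≡ a ∷ [] ⊎ ∃[ z ] u ≡ wrap a z a × z ⊆ x × IsPalindrome z
  palindrome-⊆-wrap {a} {x} pal (_ ∷ʳ s) with ⊆-snoc⁻ x s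
  ... | inj₁ u⊆x                  = inj₁ u⊆x
  ... | inj₂ ([] , refl , _)      = inj₂ (inj₁ refl)
  ... | inj₂ (e ∷ z , refl , e∷z⊆x) with wrap-palindrome⁻ pal
  ...   | refl , palz = inj₂ (inj₂ (z , refl , ∷ˡ⁻ e∷z⊆x , palz))
  palindrome-⊆-wrap {a} {x} {_ ∷ u′} pal (refl ∷ s) with ⊆-snoc⁻ x s | reverseView u′
  ... | inj₂ (v , refl , v⊆x) | _ = inj₂ (inj₂ (v , refl , v⊆x , proj₂ (wrap-palindrome⁻ pal)))
  ... | inj₁ _    | []          = inj₂ (inj₁ refl)
  ... | inj₁ u′⊆x | z ∶ _ ∶ʳ e with wrap-palindrome⁻ pal
  ...   | refl , palz = inj₂ (inj₂ (z , refl , ⊆-trans (++⁺ʳ _ ⊆-refl) u′⊆x , palz))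

  -- Bounding SP_t(w) by a covering list (turned into a count by SP≤⇒SP) lets the recurrences
  -- ignore distinctness.
  Covers : List (List A) → ℕ → List A → Set
  Covers L t w = ∀ {u} → u ⊆ w → length u ≡ t → IsPalindrome u → u ∈ L

  SP≤ : ℕ → List A → ℕ → Set
  SP≤ t w b = ∃[ L ] length L ≤ b × Covers L t w

  SP≤-weaken : ∀ {t w b b′} → b ≤ b′ → SP≤ t w b → SP≤ t w b′
  SP≤-weaken b≤b′ (L , ∣L∣≤b , cover) = L , ≤-trans ∣L∣≤b b≤b′ , cover

  SP₀≤1 : ∀ {w} → SP≤ 0 w 1
  SP₀≤1 = [] ∷ [] , ≤-refl , λ { {[]} _ _ _ → here refl ; {_ ∷ _} _ () _ }

  SP₁≤ : ∀ {w ps : List A} → (∀ {p} → p ∈ w → p ∈ ps) → SP≤ 1 w (length ps)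
  SP₁≤ {ps = ps} w⊆ps = map (_∷ []) ps , ≤-reflexive (length-map (_∷ []) ps) , cover
    where
    cover : Covers (map (_∷ []) ps) 1 _
    cover {p ∷ []}    s _  _ = ∈-map⁺ (_∷ []) (w⊆ps (to∈ s))
    cover {[]}        _ () _
    cover {_ ∷ _ ∷ _} _ () _

  SP₂≤ : ∀ (w : List A) c → SP≤ 2 (w ++ c ∷ []) (length w)
  SP₂≤ w c = map double w , ≤-reflexive (length-map double w) , cover
    where
    double : A → List A
    double p = p ∷ p ∷ []
    cover : Covers (map double w) 2 (w ++ c ∷ [])
    cover {p ∷ q ∷ []} s _ pal with ∷-injective pal | ⊆-snoc⁻ w s
    ... | refl , _ | inj₁ pq⊆w                     = ∈-map⁺ double (⊆-lookup pq⊆w (here refl))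
    ... | refl , _ | inj₂ (_ ∷ _ , eq , v⊆w)       = ∈-map⁺ double (⊆-lookup v⊆w (here (∷-injectiveˡ eq)))
    ... | refl , _ | inj₂ ([] , () , _)
    cover {[]}            _ () _
    cover {_ ∷ []}        _ () _
    cover {_ ∷ _ ∷ _ ∷ _} _ () _

  SP≤-length : ∀ {t} {w : List A} → length w ≡ t → SP≤ t w 1
  SP≤-length {w = w} ∣w∣≡t = w ∷ [] , ≤-refl , λ u⊆w ∣u∣≡t _ →
    here (⊆⇒≡ u⊆w (trans ∣u∣≡t (sym ∣w∣≡t)))

  SP≤-length-¬palindrome : ∀ {t} {w : List A} → ¬ IsPalindrome w → length w ≡ t → SP≤ t w 0
  SP≤-length-¬palindrome ¬pal ∣w∣≡t = [] , ≤-refl , λ u⊆w ∣u∣≡t pal →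
    ⊥-elim (¬pal (subst IsPalindrome (⊆⇒≡ u⊆w (trans ∣u∣≡t (sym ∣w∣≡t))) pal))

  SP≤-long : ∀ {t} {w : List A} → length w < t → SP≤ t w 0
  SP≤-long {w = w} ∣w∣<t = [] , ≤-refl , λ u⊆w ∣u∣≡t _ →
    ⊥-elim (<⇒≱ ∣w∣<t (subst (_≤ length w) ∣u∣≡t (length-mono-≤ u⊆w)))

  SP≤-wrap : ∀ {a t b₁ b₂} {x : List A} →
             SP≤ (2 + t) x b₁ → SP≤ t x b₂ → SP≤ (2 + t) (wrap a x a) (b₁ + b₂)
  SP≤-wrap {a} {t} {x = x} (L₁ , ∣L₁∣≤ , cover₁) (L₂ , ∣L₂∣≤ , cover₂) =
    L₁ ++ map (λ z → wrap a z a) L₂ , bound , cover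
    where
    bound = ≤-trans (≤-reflexive (trans (length-++ L₁) (cong (length L₁ +_) (length-map _ L₂))))
                    (+-mono-≤ ∣L₁∣≤ ∣L₂∣≤)
    cover : Covers (L₁ ++ map (λ z → wrap a z a) L₂) (2 + t) (wrap a x a)
    cover u⊆w ∣u∣ pal with palindrome-⊆-wrap pal u⊆w
    ... | inj₁ u⊆x                         = ∈-++⁺ˡ (cover₁ u⊆x ∣u∣ pal)
    ... | inj₂ (inj₁ refl)                 with () ← ∣u∣
    ... | inj₂ (inj₂ (z , refl , z⊆x , palz)) =
      ∈-++⁺ʳ L₁ (∈-map⁺ (λ z → wrap a z a) (cover₂ z⊆x ∣z∣ palz))
      where ∣z∣ = suc-injective (suc-injective (trans (sym (length-wrap a z a)) ∣u∣))

  SP≤-wrap-distinct : ∀ {a c t b₁ b₂} {x : List A} → ¬ a ≡ c →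
                      SP≤ t (a ∷ x) b₁ → SP≤ t (x ++ c ∷ []) b₂ → SP≤ t (wrap a x c) (b₁ + b₂)
  SP≤-wrap-distinct a≢c (L₁ , ∣L₁∣≤ , cover₁) (L₂ , ∣L₂∣≤ , cover₂) =
    L₁ ++ L₂ , ≤-trans (≤-reflexive (length-++ L₁)) (+-mono-≤ ∣L₁∣≤ ∣L₂∣≤) , cover
    where
    cover : Covers (L₁ ++ L₂) _ _
    cover u⊆w ∣u∣ pal with palindrome-⊆-wrap-distinct a≢c pal u⊆w
    ... | inj₁ u⊆a∷x = ∈-++⁺ˡ (cover₁ u⊆a∷x ∣u∣ pal)
    ... | inj₂ u⊆x∷ʳc = ∈-++⁺ʳ L₁ (cover₂ u⊆x∷ʳc ∣u∣ pal)

  data Unwrap : List A → Set where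
    empty   : Unwrap []
    single  : ∀ a → Unwrap (a ∷ [])
    wrapped : ∀ a {x} → Unwrap x → ∀ c → Unwrap (wrap a x c)

  unwrap : ∀ w → Unwrap w
  unwrap w = go (length w) w ≤-refl
    where
    go : ∀ n w → length w ≤ n → Unwrap w
    go _       []      _ = empty
    go (suc n) (a ∷ r) (s≤s ∣r∣≤n) with reverseView r
    ... | []           = single a
    ... | x ∶ _ ∶ʳ c   = wrapped a (go n x ∣x∣≤n) c
      where ∣x∣≤n = ≤-trans (length-mono-≤ (++⁺ʳ (c ∷ []) (⊆-refl {x = x}))) ∣r∣≤n

module _ {A : Set} (_≟_ : DecidableEquality A) where

  private
    SP[n∸1]-view : ∀ {w : List A} → Unwrap w → SP≤ (length w ∸ 1) w 2
    SP[n∸1]-equalEnds : ∀ {x : List A} → Unwrap x → ∀ a → SP≤ (suc (length x)) (wrap a x a) 2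

    SP[n∸1]-view empty = SP≤-weaken (s≤s z≤n) SP₀≤1
    SP[n∸1]-view (single a) = SP≤-weaken (s≤s z≤n) SP₀≤1
    SP[n∸1]-view (wrapped a {x} v c) rewrite length-snoc x c with a ≟ c
    ... | yes refl = SP[n∸1]-equalEnds v a
    ... | no a≢c   = SP≤-wrap-distinct a≢c (SP≤-length refl) (SP≤-length (length-snoc x c))

    SP[n∸1]-equalEnds empty a = SP₁≤ (λ p∈ → p∈)
    SP[n∸1]-equalEnds v@(single _) a = SP≤-wrap (SP≤-long ≤-refl) (SP[n∸1]-view v)
    SP[n∸1]-equalEnds v@(wrapped _ _ _) a = SP≤-wrap (SP≤-long ≤-refl) (SP[n∸1]-view v)

  SP[n∸1]≤2 : ∀ {t} (w : List A) → suc t ≡ length w → SP≤ t w 2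
  SP[n∸1]≤2 w 1+t≡∣w∣ = subst (λ t → SP≤ t w 2) (cong (_∸ 1) (sym 1+t≡∣w∣)) (SP[n∸1]-view (unwrap w))

  SP[n∸2]-distinctEnds : ∀ {b d} → ¬ b ≡ d → ∀ y →
                         SP≤ (length y) (wrap b y d) (suc ⌈ 2 + length y /2⌉)
  SP[n∸2]-distinctEnds _ [] = SP≤-weaken (s≤s z≤n) SP₀≤1
  SP[n∸2]-distinctEnds _ (e ∷ []) = SP₁≤ (λ p∈ → p∈)
  SP[n∸2]-distinctEnds {b} {d} _ (e ∷ f ∷ []) = SP₂≤ (b ∷ e ∷ f ∷ []) d
  SP[n∸2]-distinctEnds {b} {d} b≢d y@(_ ∷ _ ∷ _ ∷ _) =
    SP≤-weaken (s≤s (s≤s (s≤s (s≤s z≤n))))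
      (SP≤-wrap-distinct b≢d (SP[n∸1]≤2 (b ∷ y) refl)
                             (SP[n∸1]≤2 (y ++ d ∷ []) (sym (length-snoc y d))))

  SP[n∸2]-equalEnds : ∀ {x : List A} → Unwrap x → ∀ a →
                      SP≤ (length x) (wrap a x a) ⌈ 2 + length x /2⌉
  SP[n∸2]-equalEnds empty a = SP₀≤1
  SP[n∸2]-equalEnds (single e) a = SP₁≤ {ps = a ∷ e ∷ []} λ
    { (here refl) → here refl ; (there (here refl)) → there (here refl) ; (there (there (here refl))) → here refl }
  SP[n∸2]-equalEnds (wrapped b {y} v d) a with b ≟ d
  SP[n∸2]-equalEnds (wrapped b {y} v .b) a | yes refl =
    cast (SP≤-wrap (SP≤-length (length-wrap b y b)) (SP[n∸2]-equalEnds v b))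
    where cast = subst (λ n → SP≤ n (wrap a (wrap b y b) a) ⌈ 2 + n /2⌉) (sym (length-wrap b y b))
  SP[n∸2]-equalEnds (wrapped b {y} v d) a | no b≢d =
    cast (SP≤-wrap (SP≤-length-¬palindrome (b≢d ∘ proj₁ ∘ wrap-palindrome⁻) (length-wrap b y d))
                   (SP[n∸2]-distinctEnds b≢d y))
    where cast = subst (λ n → SP≤ n (wrap a (wrap b y d) a) ⌈ 2 + n /2⌉) (sym (length-wrap b y d))

module _ {B : Set} where

  Unique⇒length≤ : ∀ {xs ys : List B} → Unique xs → (∀ {z} → z ∈ xs → z ∈ ys) →
                   length xs ≤ length ys
  Unique⇒length≤ {[]}     _                 _     = z≤n
  Unique⇒length≤ {x ∷ xs} (x∉xs ∷ unique-xs) xs⊆ys with ∈-∃++ (xs⊆ys (here refl))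
  ... | ys₁ , ys₂ , refl =
    ≤-trans (s≤s (Unique⇒length≤ unique-xs xs⊆ys₁++ys₂)) (≤-reflexive (sym (length-++-sucʳ ys₁ x ys₂)))
    where
    xs⊆ys₁++ys₂ : ∀ {z} → z ∈ xs → z ∈ ys₁ ++ ys₂
    xs⊆ys₁++ys₂ z∈xs with ∈-++⁻ ys₁ (xs⊆ys (there z∈xs))
    ... | inj₁ z∈ys₁         = ∈-++⁺ˡ z∈ys₁
    ... | inj₂ (here refl)   = ⊥-elim (All.lookup x∉xs z∈xs refl)
    ... | inj₂ (there z∈ys₂) = ∈-++⁺ʳ ys₁ z∈ys₂

module _ {A : Set} where

  ∈-scatteredSubwords⁻ : ∀ t (w : List A) {u} → u ∈ scatteredSubwords t w → u ⊆ w × length u ≡ t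
  ∈-scatteredSubwords⁻ 0       w       (here refl) = []⊆-universal w , refl
  ∈-scatteredSubwords⁻ (suc t) (x ∷ w) u∈ with ∈-++⁻ (map (x ∷_) (scatteredSubwords t w)) u∈
  ... | inj₂ u∈skip with ∈-scatteredSubwords⁻ (suc t) w u∈skip
  ...   | u⊆w , ∣u∣ = x ∷ʳ u⊆w , ∣u∣
  ∈-scatteredSubwords⁻ (suc t) (x ∷ w) u∈ | inj₁ u∈keep with ∈-map⁻ (x ∷_) u∈keep
  ...   | v , v∈ , refl with ∈-scatteredSubwords⁻ t w v∈
  ...     | v⊆w , ∣v∣ = refl ∷ v⊆w , cong suc ∣v∣

  SP≤⇒SP : ∀ (_≟_ : DecidableEquality A) {t w b} → SP≤ t w b → SP _≟_ t w ≤ b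
  SP≤⇒SP _≟_ {t} {w} (L , ∣L∣≤b , cover) =
    ≤-trans (Unique⇒length≤ (UniqueDec.deduplicate-! (≡-dec _≟_) palindromes) ∈L) ∣L∣≤b
    where
    palindromes = filter (λ u → ≡-dec _≟_ u (reverse u)) (scatteredSubwords t w)
    ∈L : ∀ {u} → u ∈ deduplicate (≡-dec _≟_) palindromes → u ∈ L
    ∈L u∈ with ∈-filter⁻ (λ u → ≡-dec _≟_ u (reverse u)) (∈-deduplicate⁻ (≡-dec _≟_) palindromes u∈)
    ... | u∈subwords , pal with ∈-scatteredSubwords⁻ t w u∈subwords
    ...   | u⊆w , ∣u∣ = cover u⊆w ∣u∣ pal

  lookup-last : ∀ a (x : List A) c .{p : length (x ++ c ∷ []) < length (wrap a x c)} →
                lookup (wrap a x c) (fromℕ< p) ≡ c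
  lookup-last a []      c = refl
  lookup-last a (y ∷ x) c = lookup-last y x c

lemma4p14 : {A : Set} (_≟_ : DecidableEquality A) (w : List A) (n2 : 2 ≤ length w) →
    firstLetter w n2 ≡ lastLetter w n2 →
    SP _≟_ (length w ∸ 2) w ≤ ⌈ length w /2⌉
lemma4p14 _≟_ w n2 first≡last with unwrap w
lemma4p14 _≟_ .[]        ()      _ | empty
lemma4p14 _≟_ .(_ ∷ [])  (s≤s ()) _ | single _
... | wrapped a {x} v c with trans first≡last (lookup-last a x c)
... | refl = subst (λ n → SP _≟_ (n ∸ 2) (wrap a x a) ≤ ⌈ n /2⌉) (sym (length-wrap a x a))
                   (SP≤⇒SP _≟_ (SP[n∸2]-equalEnds _≟_ v a))
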